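{- Work over $\mathbb{F}_3$. Let $n,d$ be positive integers and $\beta:\mathbb{F}_3^n\to\mathbb{F}_3$. Let $Q^\beta := \sum_{x\in\mathbb{F}_3^n} \beta(x)\, e_x e_x^T$ and let $\Delta := \Delta(\beta, \mathsf{P}^n_{2n-2d-1})$. Then $\rank(Q^\beta) \leq \Delta$.
   Context: $\mathsf{P}^n_D$ denotes the set of polynomials in $n$ variables over $\mathbb{F}_3$ of degree at most $D$ with individual degrees at most $2$, viewed as functions $\mathbb{F}_3^n\to\mathbb{F}_3$. For $a\in\{0,1,2\}^n$, $|a|=\sum_i a_i$ and $x^a=\prod_i x_i^{a_i}$. For $x\in\mathbb{F}_3^n$, $e_x$ is the column vector $(x^a)_{a\in\{0,1,2\}^n,\,|a|\le d}$ of evaluations at $x$ of all monomials of degree at most $d$. $Q^\beta$ is a symmetric matrix over $\mathbb{F}_3$ and rank is over $\mathbb{F}_3$. $\Delta(\beta,S)$ is the minimum Hamming distance (number of points of disagreement) from $\beta$ to a function in $S$. -}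

module Defs where

open import Data.Nat as ℕ using (ℕ; zero; suc; _+_; _*_)
open import Data.Integer as ℤ using (ℤ; +_)
open import Data.Fin using (Fin; zero; suc; toℕ)
open import Data.Fin.Properties using () renaming (_≟_ to _≟F_)
open import Data.List as List using (List; []; _∷_; concatMap; foldr; length; filter)
open import Data.Product using (Σ; _×_; _,_; ∃; proj₁)
open import Relation.Binary.PropositionalEquality using (_≡_; _≢_)
open import Relation.Nullary using (¬_)
open import Relation.Nullary.Decidable using (¬?)

F3 : Set
F3 = Fin 3

0F 1F 2F : F3
0F = zero
1F = suc zero
2F = suc (suc zero)

_+₃_ : F3 → F3 → F3
zero +₃ y = y
suc zero +₃ zero = 1F
suc zero +₃ suc zero = 2F
suc zero +₃ suc (suc zero) = 0F
suc (suc zero) +₃ zero = 2F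
suc (suc zero) +₃ suc zero = 0F
suc (suc zero) +₃ suc (suc zero) = 1F

_*₃_ : F3 → F3 → F3
zero *₃ y = 0F
suc zero *₃ y = y
suc (suc zero) *₃ zero = 0F
suc (suc zero) *₃ suc zero = 2F
suc (suc zero) *₃ suc (suc zero) = 1F

sum₃ : List F3 → F3
sum₃ = foldr _+₃_ 0F

Pt : ℕ → Set
Pt n = Fin n → F3

Exp : ℕ → Set
Exp n = Fin n → Fin 3

allFns : (n : ℕ) → List (Fin n → Fin 3)
allFns zero = (λ ()) ∷ []
allFns (suc n) =
  concatMap (λ v → List.map (λ c → cons c v) (0F ∷ 1F ∷ 2F ∷ [])) (allFns n)
  where
  cons : F3 → (Fin n → F3) → Fin (suc n) → F3
  cons c v zero = c
  cons c v (suc i) = v i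

∣_∣ₑ : {n : ℕ} → Exp n → ℕ
∣_∣ₑ {zero} a = 0
∣_∣ₑ {suc n} a = toℕ (a zero) + ∣ (λ i → a (suc i)) ∣ₑ

-- t^k for k ∈ {0,1,2}  (with 0^0 = 1)
pow₃ : F3 → Fin 3 → F3
pow₃ t zero = 1F
pow₃ t (suc zero) = t
pow₃ t (suc (suc zero)) = t *₃ t

mono : {n : ℕ} → Exp n → Pt n → F3
mono {zero} a x = 1F
mono {suc n} a x = pow₃ (x zero) (a zero) *₃ mono (λ i → a (suc i)) (λ i → x (suc i))

Idx : ℕ → ℕ → Set
Idx n d = Σ (Exp n) (λ a → ∣ a ∣ₑ ℕ.≤ d)

eVec : {n : ℕ} (d : ℕ) → Pt n → Idx n d → F3
eVec d x (a , _) = mono a x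

Qβ : (n d : ℕ) → (Pt n → F3) → Idx n d → Idx n d → F3
Qβ n d β i j = sum₃ (List.map (λ x → β x *₃ (eVec d x i *₃ eVec d x j)) (allFns n))

-- Rank over F₃.  rank(M) = the maximal size of a linearly independent
-- family of columns of M.  We express "rank M ≤ m" as: every linearly
-- independent family of columns has at most m members.

sumFin : (k : ℕ) → (Fin k → F3) → F3
sumFin zero f = 0F
sumFin (suc k) f = f zero +₃ sumFin k (λ i → f (suc i))

LinIndepCols : {I : Set} → (I → I → F3) → (k : ℕ) → (Fin k → I) → Set
LinIndepCols {I} M k cols =
  (c : Fin k → F3) →
  ((r : I) → sumFin k (λ t → c t *₃ M r (cols t)) ≡ 0F) →
  (t : Fin k) → c t ≡ 0F

RankAtMost : {I : Set} → (I → I → F3) → ℕ → Set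
RankAtMost {I} M m =
  (k : ℕ) (cols : Fin k → I) → LinIndepCols M k cols → k ℕ.≤ m

-- Polynomials in Pⁿ_D: coefficient functions on exponent vectors in
-- {0,1,2}ⁿ (individual degrees ≤ 2) supported on |a| ≤ D.  D is an
-- integer (it may be negative, in which case only the zero polynomial).

Coeffs : ℕ → Set
Coeffs n = Exp n → F3

InPD : {n : ℕ} → ℤ → Coeffs n → Set
InPD {n} D c = (a : Exp n) → c a ≢ 0F → (+ ∣ a ∣ₑ) ℤ.≤ D

evalPoly : {n : ℕ} → Coeffs n → Pt n → F3
evalPoly {n} c x = sum₃ (List.map (λ a → c a *₃ mono a x) (allFns n))

hamming : {n : ℕ} → (Pt n → F3) → (Pt n → F3) → ℕ
hamming {n} f g = length (filter (λ x → ¬? (f x ≟F g x)) (allFns n))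

IsDelta : {n : ℕ} → (Pt n → F3) → ℤ → ℕ → Set
IsDelta {n} β D δ =
  (∃ λ (c : Coeffs n) → InPD D c × hamming β (evalPoly c) ≡ δ) ×
  ((c : Coeffs n) → InPD D c → δ ℕ.≤ hamming β (evalPoly c))

degBound : ℕ → ℕ → ℤ
degBound n d = (+ (2 * n)) ℤ.- (+ (2 * d)) ℤ.- (+ 1)

-- Writing β = p + γ with p ∈ Pⁿ_{2n-2d-1} at distance Δ from β, the matrix Q^β splits as Q^p + Q^γ.
-- Every entry of Q^p is Σ_x p(x) x^a x^b with deg p + |a| + |b| < 2n, and such a sum vanishes:
-- it factors coordinatewise into sums Σ_{t ∈ F₃} t^m, which are 0 unless m ≥ 2, so some coordinate
-- kills it.  Hence Q^β = Q^γ = Σ_{x : γ(x) ≠ 0} γ(x) e_x e_xᵀ is a sum of Δ rank-one matrices.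
module Submission where

open import Defs
open import Level using (0ℓ)
open import Relation.Binary.PropositionalEquality
open import Relation.Binary.PropositionalEquality.Algebra using (isMagma)
open import Algebra.Bundles using (CommutativeRing)
open import Algebra.Structures {A = F3} (_≡_) using (IsCommutativeRing)
import Algebra.Properties.CommutativeSemigroup as CommutativeSemigroupProperties
import Algebra.Properties.Group as GroupProperties
open import Tactic.RingSolver.Core.AlmostCommutativeRing
  using (AlmostCommutativeRing; fromCommutativeRing)
open import Tactic.RingSolver using (solve-∀)
open import Data.Nat using (ℕ; zero; suc; _+_; _*_; _≤_; _<_; _^_; s≤s; z≤n)
import Data.Nat.Properties as ℕ
open import Data.Nat.Solver using (module +-*-Solver)
open import Data.Integer as ℤ using (+_)
import Data.Integer.Properties as ℤP
open import Data.Integer.Solver using () renaming (module +-*-Solver to ℤ-Solver)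
open import Data.Fin using (Fin; zero; suc; toℕ; funToFin; finToFun; combine)
import Data.Fin.Properties as FinP
open FinP using (all?; pigeonhole; ¬∀⟶∃¬; finToFun-funToFin; funToFin-finToFin) renaming (_≟_ to _≟F_)
open import Data.List
  using (List; []; _∷_; map; concatMap; filter; length; lookup; _++_; allFin; tabulate)
open import Data.List.Properties using (map-cong; map-tabulate)
open import Data.Product using (∃; ∃₂; _×_; _,_)
open import Data.Sum using (_⊎_; inj₁; inj₂)
open import Function using (_∘_)
open import Relation.Nullary using (¬_; yes; no; contradiction)
open import Relation.Nullary.Decidable using (from-yes; _⊎-dec_; ¬?; decidable-stable; dec⇒maybe)
open import Relation.Unary using (Decidable)

-₃_ : F3 → F3
-₃_ zero = 0F
-₃_ (suc zero) = 2F
-₃_ (suc (suc zero)) = 1F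

F3-isCommutativeRing : IsCommutativeRing _+₃_ _*₃_ -₃_ 0F 1F
F3-isCommutativeRing = record
  { isRing = record
    { +-isAbelianGroup = record
      { isGroup = record
        { isMonoid = record
          { isSemigroup = record
            { isMagma = isMagma _+₃_
            ; assoc = from-yes (all? λ x → all? λ y → all? λ z → (x +₃ y) +₃ z ≟F x +₃ (y +₃ z))
            }
          ; identity = from-yes (all? λ x → 0F +₃ x ≟F x) , from-yes (all? λ x → x +₃ 0F ≟F x)
          }
        ; inverse = from-yes (all? λ x → (-₃ x) +₃ x ≟F 0F) , from-yes (all? λ x → x +₃ (-₃ x) ≟F 0F)
        ; ⁻¹-cong = cong -₃_
        }
      ; comm = from-yes (all? λ x → all? λ y → x +₃ y ≟F y +₃ x)
      }
    ; *-cong = cong₂ _*₃_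
    ; *-assoc = from-yes (all? λ x → all? λ y → all? λ z → (x *₃ y) *₃ z ≟F x *₃ (y *₃ z))
    ; *-identity = from-yes (all? λ x → 1F *₃ x ≟F x) , from-yes (all? λ x → x *₃ 1F ≟F x)
    ; distrib = from-yes (all? λ x → all? λ y → all? λ z → x *₃ (y +₃ z) ≟F (x *₃ y) +₃ (x *₃ z))
              , from-yes (all? λ x → all? λ y → all? λ z → (y +₃ z) *₃ x ≟F (y *₃ x) +₃ (z *₃ x))
    }
  ; *-comm = from-yes (all? λ x → all? λ y → x *₃ y ≟F y *₃ x)
  }

F3-commutativeRing : CommutativeRing 0ℓ 0ℓ
F3-commutativeRing = record { isCommutativeRing = F3-isCommutativeRing }

F3-almostCommutativeRing : AlmostCommutativeRing 0ℓ 0ℓ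
F3-almostCommutativeRing = fromCommutativeRing F3-commutativeRing (λ x → dec⇒maybe (0F ≟F x))

open CommutativeRing F3-commutativeRing
  using (+-assoc; +-identityʳ; -‿inverseʳ; *-assoc; distribˡ; distribʳ; zeroˡ; zeroʳ;
         +-commutativeSemigroup; *-commutativeSemigroup; +-group)
open CommutativeSemigroupProperties +-commutativeSemigroup using (interchange)
open CommutativeSemigroupProperties *-commutativeSemigroup using (x∙yz≈y∙xz)
open GroupProperties +-group using (x∙y⁻¹≈ε⇒x≈y)

x*z≡[x-y]*z+y*z : ∀ x y z → x *₃ z ≡ ((x +₃ (-₃ y)) *₃ z) +₃ (y *₃ z)
x*z≡[x-y]*z+y*z = solve-∀ F3-almostCommutativeRing

[x-y]*z≡x*z-y*z : ∀ x y z → (x +₃ (-₃ y)) *₃ z ≡ (x *₃ z) +₃ (-₃ (y *₃ z))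
[x-y]*z≡x*z-y*z = solve-∀ F3-almostCommutativeRing

-‿interchange : ∀ a b c d → (a +₃ (-₃ b)) +₃ (c +₃ (-₃ d)) ≡ (a +₃ c) +₃ (-₃ (b +₃ d))
-‿interchange = solve-∀ F3-almostCommutativeRing

module _ {X : Set} where

  sum₃-cong : (L : List X) {f g : X → F3} → (∀ x → f x ≡ g x) → sum₃ (map f L) ≡ sum₃ (map g L)
  sum₃-cong L f≗g = cong sum₃ (map-cong f≗g L)

  sum₃-+ : (L : List X) (f g : X → F3) →
           sum₃ (map (λ x → f x +₃ g x) L) ≡ sum₃ (map f L) +₃ sum₃ (map g L)
  sum₃-+ [] f g = refl
  sum₃-+ (x ∷ L) f g = trans (cong ((f x +₃ g x) +₃_) (sum₃-+ L f g)) (interchange (f x) (g x) _ _)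

  sum₃-*ˡ : (L : List X) (c : F3) (f : X → F3) → c *₃ sum₃ (map f L) ≡ sum₃ (map (λ x → c *₃ f x) L)
  sum₃-*ˡ [] c f = zeroʳ c
  sum₃-*ˡ (x ∷ L) c f = trans (distribˡ c (f x) _) (cong ((c *₃ f x) +₃_) (sum₃-*ˡ L c f))

  sum₃-*ʳ : (L : List X) (c : F3) (f : X → F3) → sum₃ (map f L) *₃ c ≡ sum₃ (map (λ x → f x *₃ c) L)
  sum₃-*ʳ [] c f = zeroˡ c
  sum₃-*ʳ (x ∷ L) c f = trans (distribʳ c (f x) _) (cong ((f x *₃ c) +₃_) (sum₃-*ʳ L c f))

  sum₃-sub : (L : List X) (f g : X → F3) →
           sum₃ (map (λ x → f x +₃ (-₃ g x)) L) ≡ sum₃ (map f L) +₃ (-₃ sum₃ (map g L))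
  sum₃-sub [] f g = refl
  sum₃-sub (x ∷ L) f g =
    trans (cong ((f x +₃ (-₃ g x)) +₃_) (sum₃-sub L f g)) (-‿interchange (f x) (g x) _ _)

  sum₃-zero : (L : List X) (f : X → F3) → (∀ i → f (lookup L i) ≡ 0F) → sum₃ (map f L) ≡ 0F
  sum₃-zero [] f f≡0 = refl
  sum₃-zero (x ∷ L) f f≡0 = cong₂ _+₃_ (f≡0 zero) (sum₃-zero L f (f≡0 ∘ suc))

  sum₃-++ : (L L′ : List X) (f : X → F3) →
            sum₃ (map f (L ++ L′)) ≡ sum₃ (map f L) +₃ sum₃ (map f L′)
  sum₃-++ [] L′ f = refl
  sum₃-++ (x ∷ L) L′ f = trans (cong (f x +₃_) (sum₃-++ L L′ f)) (sym (+-assoc (f x) _ _))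

  sum₃-filter : {P : X → Set} (P? : Decidable P) (L : List X) (f : X → F3) →
                (∀ x → ¬ P x → f x ≡ 0F) → sum₃ (map f L) ≡ sum₃ (map f (filter P? L))
  sum₃-filter P? [] f f≡0 = refl
  sum₃-filter P? (x ∷ L) f f≡0 with P? x
  ... | yes _ = cong (f x +₃_) (sum₃-filter P? L f f≡0)
  ... | no ¬Px = cong₂ _+₃_ (f≡0 x ¬Px) (sum₃-filter P? L f f≡0)

sum₃-concatMap : {X Y : Set} (g : X → List Y) (L : List X) (f : Y → F3) →
                 sum₃ (map f (concatMap g L)) ≡ sum₃ (map (λ x → sum₃ (map f (g x))) L)
sum₃-concatMap g [] f = refl
sum₃-concatMap g (x ∷ L) f =
  trans (sum₃-++ (g x) (concatMap g L) f) (cong (sum₃ (map f (g x)) +₃_) (sum₃-concatMap g L f))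

sum₃-comm : {X Y : Set} (L : List X) (L′ : List Y) (f : X → Y → F3) →
            sum₃ (map (λ x → sum₃ (map (f x) L′)) L) ≡ sum₃ (map (λ y → sum₃ (map (λ x → f x y) L)) L′)
sum₃-comm [] L′ f = sym (sum₃-zero L′ _ (λ _ → refl))
sum₃-comm (x ∷ L) L′ f =
  trans (cong (sum₃ (map (f x) L′) +₃_) (sum₃-comm L L′ f)) (sym (sum₃-+ L′ (f x) _))

sumFin≡sum₃-allFin : (k : ℕ) (f : Fin k → F3) → sumFin k f ≡ sum₃ (map f (allFin k))
sumFin≡sum₃-allFin zero f = refl
sumFin≡sum₃-allFin (suc k) f = cong (f zero +₃_) (begin
  sumFin k (f ∘ suc)                  ≡⟨ sumFin≡sum₃-allFin k (f ∘ suc) ⟩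
  sum₃ (map (f ∘ suc) (allFin k))      ≡⟨ cong sum₃ (map-tabulate (λ i → i) (f ∘ suc)) ⟩
  sum₃ (tabulate (f ∘ suc))            ≡⟨ cong sum₃ (map-tabulate suc f) ⟨
  sum₃ (map f (tabulate suc))          ∎)
  where open ≡-Reasoning

-- Rank of a sum of rank-one matrices

funToFin-cong : {m n : ℕ} {f g : Fin m → Fin n} → (∀ i → f i ≡ g i) → funToFin f ≡ funToFin g
funToFin-cong {zero} f≗g = refl
funToFin-cong {suc m} f≗g = cong₂ combine (f≗g zero) (funToFin-cong (f≗g ∘ suc))

-- Pigeonhole on the 3^k vectors of F₃ᵏ mapped into the 3^m vectors of F₃ᵐ.
collision : {m k : ℕ} → m < k → (F : (Fin k → F3) → Fin m → F3) →
            ∃₂ λ u w → (∃ λ t → u t ≢ w t) × (∀ s → F u s ≡ F w s)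
collision {m} {k} m<k F
  with i , j , i<j , Fi≡Fj ← pigeonhole (ℕ.^-monoʳ-< 3 (s≤s (s≤s z≤n)) m<k) (funToFin ∘ F ∘ finToFun)
  = vec i , vec j , ¬∀⟶∃¬ k _ (λ t → vec i t ≟F vec j t) i≢j , F-agrees
  where
  open ≡-Reasoning
  vec : Fin (3 ^ k) → Fin k → F3
  vec = finToFun
  i≢j : ¬ (∀ t → vec i t ≡ vec j t)
  i≢j u≗w = FinP.<-irrefl (begin
    i                   ≡⟨ funToFin-finToFin {k} {3} i ⟨
    funToFin (vec i)    ≡⟨ funToFin-cong u≗w ⟩
    funToFin (vec j)    ≡⟨ funToFin-finToFin {k} {3} j ⟩
    j                   ∎) i<j
  F-agrees : ∀ s → F (vec i) s ≡ F (vec j) s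
  F-agrees s = begin
    F (vec i) s                          ≡⟨ finToFun-funToFin (F (vec i)) s ⟨
    finToFun (funToFin (F (vec i))) s     ≡⟨ cong (λ v → finToFun v s) Fi≡Fj ⟩
    finToFun (funToFin (F (vec j))) s     ≡⟨ finToFun-funToFin (F (vec j)) s ⟩
    F (vec j) s                          ∎

kernel-nontrivial : {m k : ℕ} → m < k → (A : Fin m → Fin k → F3) →
                    ∃ λ c → (∃ λ t → c t ≢ 0F) × (∀ s → sumFin k (λ t → c t *₃ A s t) ≡ 0F)
kernel-nontrivial {m} {k} m<k A
  with u , w , (t , ut≢wt) , Au≡Aw ← collision m<k (λ v s → sumFin k (λ t → v t *₃ A s t))
  = (λ t → u t +₃ (-₃ w t)) , (t , ut≢wt ∘ x∙y⁻¹≈ε⇒x≈y (u t) (w t)) , u-w∈ker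
  where
  open ≡-Reasoning
  u-w∈ker : ∀ s → sumFin k (λ t → (u t +₃ (-₃ w t)) *₃ A s t) ≡ 0F
  u-w∈ker s = begin
    sumFin k (λ t → (u t +₃ (-₃ w t)) *₃ A s t)
      ≡⟨ sumFin≡sum₃-allFin k _ ⟩
    sum₃ (map (λ t → (u t +₃ (-₃ w t)) *₃ A s t) (allFin k))
      ≡⟨ sum₃-cong (allFin k) (λ t → [x-y]*z≡x*z-y*z (u t) (w t) (A s t)) ⟩
    sum₃ (map (λ t → (u t *₃ A s t) +₃ (-₃ (w t *₃ A s t))) (allFin k))
      ≡⟨ sum₃-sub (allFin k) _ _ ⟩
    sum₃ (map (λ t → u t *₃ A s t) (allFin k)) +₃ (-₃ sum₃ (map (λ t → w t *₃ A s t) (allFin k)))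
      ≡⟨ cong₂ (λ a b → a +₃ (-₃ b)) (sumFin≡sum₃-allFin k _) (sumFin≡sum₃-allFin k _) ⟨
    sumFin k (λ t → u t *₃ A s t) +₃ (-₃ sumFin k (λ t → w t *₃ A s t))
      ≡⟨ cong (_+₃ (-₃ sumFin k (λ t → w t *₃ A s t))) (Au≡Aw s) ⟩
    sumFin k (λ t → w t *₃ A s t) +₃ (-₃ sumFin k (λ t → w t *₃ A s t))
      ≡⟨ -‿inverseʳ (sumFin k (λ t → w t *₃ A s t)) ⟩
    0F ∎

RankAtMost-sum-of-outer : {I X : Set} (M : I → I → F3) (L : List X) (u v : X → I → F3) →
                          (∀ r j → M r j ≡ sum₃ (map (λ x → u x r *₃ v x j) L)) →
                          RankAtMost M (length L)
RankAtMost-sum-of-outer M L u v M≡ k cols independent with k ℕ.≤? length L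
... | yes k≤∣L∣ = k≤∣L∣
... | no k≰∣L∣
  with c , (t , ct≢0) , c∈ker ← kernel-nontrivial (ℕ.≰⇒> k≰∣L∣) (λ s t → v (lookup L s) (cols t))
  = contradiction (independent c annihilates t) ct≢0
  where
  open ≡-Reasoning
  annihilates : ∀ r → sumFin k (λ t → c t *₃ M r (cols t)) ≡ 0F
  annihilates r = begin
    sumFin k (λ t → c t *₃ M r (cols t))
      ≡⟨ sumFin≡sum₃-allFin k _ ⟩
    sum₃ (map (λ t → c t *₃ M r (cols t)) (allFin k))
      ≡⟨ sum₃-cong (allFin k) (λ t → trans (cong (c t *₃_) (M≡ r (cols t))) (sum₃-*ˡ L (c t) _)) ⟩
    sum₃ (map (λ t → sum₃ (map (λ x → c t *₃ (u x r *₃ v x (cols t))) L)) (allFin k))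
      ≡⟨ sum₃-comm (allFin k) L _ ⟩
    sum₃ (map (λ x → sum₃ (map (λ t → c t *₃ (u x r *₃ v x (cols t))) (allFin k))) L)
      ≡⟨ sum₃-cong L (λ x → sum₃-cong (allFin k) (λ t → x∙yz≈y∙xz (c t) (u x r) _)) ⟩
    sum₃ (map (λ x → sum₃ (map (λ t → u x r *₃ (c t *₃ v x (cols t))) (allFin k))) L)
      ≡⟨ sum₃-cong L (λ x → sum₃-*ˡ (allFin k) (u x r) _) ⟨
    sum₃ (map (λ x → u x r *₃ sum₃ (map (λ t → c t *₃ v x (cols t)) (allFin k))) L)
      ≡⟨ sum₃-zero L _ (λ s → trans (cong (u (lookup L s) r *₃_)
                                          (trans (sym (sumFin≡sum₃-allFin k _)) (c∈ker s)))
                                    (zeroʳ _)) ⟩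
    0F ∎

-- Sums of monomials over F₃ⁿ

powerSum : Fin 3 → Fin 3 → Fin 3 → F3
powerSum i j k = sum₃ (map (λ t → pow₃ t i *₃ (pow₃ t j *₃ pow₃ t k)) (0F ∷ 1F ∷ 2F ∷ []))

-- Σ_{t ∈ F₃} t^m is 0 unless m is even and positive.
powerSum≡0⊎2≤ : ∀ i j k → powerSum i j k ≡ 0F ⊎ 2 ≤ toℕ i + toℕ j + toℕ k
powerSum≡0⊎2≤ = from-yes (all? λ i → all? λ j → all? λ k →
  powerSum i j k ≟F 0F ⊎-dec 2 ℕ.≤? toℕ i + toℕ j + toℕ k)

tripleMonomialSum : (n : ℕ) → Exp n → Exp n → Exp n → F3
tripleMonomialSum n e a b = sum₃ (map (λ x → mono e x *₃ (mono a x *₃ mono b x)) (allFns n))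

factor-first-coordinate : ∀ p₀ q₀ r₀ p₁ q₁ r₁ p₂ q₂ r₂ X Y Z →
  ((p₀ *₃ X) *₃ ((q₀ *₃ Y) *₃ (r₀ *₃ Z))) +₃
    (((p₁ *₃ X) *₃ ((q₁ *₃ Y) *₃ (r₁ *₃ Z))) +₃ (((p₂ *₃ X) *₃ ((q₂ *₃ Y) *₃ (r₂ *₃ Z))) +₃ 0F))
  ≡ ((p₀ *₃ (q₀ *₃ r₀)) +₃ ((p₁ *₃ (q₁ *₃ r₁)) +₃ ((p₂ *₃ (q₂ *₃ r₂)) +₃ 0F))) *₃ (X *₃ (Y *₃ Z))
factor-first-coordinate = solve-∀ F3-almostCommutativeRing

tripleMonomialSum-suc : (n : ℕ) (e a b : Exp (suc n)) →
  tripleMonomialSum (suc n) e a b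
    ≡ powerSum (e zero) (a zero) (b zero) *₃ tripleMonomialSum n (e ∘ suc) (a ∘ suc) (b ∘ suc)
tripleMonomialSum-suc n e a b = begin
  tripleMonomialSum (suc n) e a b
    ≡⟨ sum₃-concatMap _ (allFns n) _ ⟩
  -- the inner sum runs over the first coordinate t ∈ {0,1,2} of the point t ∷ v
  sum₃ (map (λ v → _) (allFns n))
    ≡⟨ sum₃-cong (allFns n) (λ v → factor-first-coordinate
         (pow₃ 0F (e zero)) (pow₃ 0F (a zero)) (pow₃ 0F (b zero))
         (pow₃ 1F (e zero)) (pow₃ 1F (a zero)) (pow₃ 1F (b zero))
         (pow₃ 2F (e zero)) (pow₃ 2F (a zero)) (pow₃ 2F (b zero))
         (mono (e ∘ suc) v) (mono (a ∘ suc) v) (mono (b ∘ suc) v)) ⟩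
  sum₃ (map (λ v → powerSum (e zero) (a zero) (b zero) *₃
                   (mono (e ∘ suc) v *₃ (mono (a ∘ suc) v *₃ mono (b ∘ suc) v)))
            (allFns n))
    ≡⟨ sum₃-*ˡ (allFns n) _ _ ⟨
  powerSum (e zero) (a zero) (b zero) *₃ tripleMonomialSum n (e ∘ suc) (a ∘ suc) (b ∘ suc) ∎
  where open ≡-Reasoning

remaining-degree< : ∀ x y z X Y Z n → (x + X) + ((y + Y) + (z + Z)) < 2 * suc n →
                    2 ≤ x + y + z → X + (Y + Z) < 2 * n
remaining-degree< x y z X Y Z n total< 2≤xyz = ℕ.+-cancelˡ-< 2 (X + (Y + Z)) (2 * n) (begin-strict
  2 + (X + (Y + Z))                          ≤⟨ ℕ.+-monoˡ-≤ (X + (Y + Z)) 2≤xyz ⟩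
  (x + y + z) + (X + (Y + Z))                ≡⟨ regroup x y z X Y Z ⟨
  (x + X) + ((y + Y) + (z + Z))              <⟨ total< ⟩
  2 * suc n                                  ≡⟨ ℕ.*-suc 2 n ⟩
  2 + 2 * n                                  ∎)
  where
  open ℕ.≤-Reasoning
  open +-*-Solver
  regroup : ∀ x y z X Y Z → (x + X) + ((y + Y) + (z + Z)) ≡ (x + y + z) + (X + (Y + Z))
  regroup = solve 6 (λ x y z X Y Z → (x :+ X) :+ ((y :+ Y) :+ (z :+ Z))
                                   := (x :+ y :+ z) :+ (X :+ (Y :+ Z))) refl

tripleMonomialSum-vanishes : (n : ℕ) (e a b : Exp n) → ∣ e ∣ₑ + (∣ a ∣ₑ + ∣ b ∣ₑ) < 2 * n →
                             tripleMonomialSum n e a b ≡ 0F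
tripleMonomialSum-vanishes zero e a b ()
tripleMonomialSum-vanishes (suc n) e a b deg<
  with powerSum≡0⊎2≤ (e zero) (a zero) (b zero)
... | inj₁ powerSum≡0 =
  trans (tripleMonomialSum-suc n e a b) (cong (_*₃ tripleMonomialSum n _ _ _) powerSum≡0)
... | inj₂ 2≤deg₀ =
  trans (tripleMonomialSum-suc n e a b)
        (trans (cong (powerSum (e zero) (a zero) (b zero) *₃_)
                     (tripleMonomialSum-vanishes n (e ∘ suc) (a ∘ suc) (b ∘ suc)
                        (remaining-degree< (toℕ (e zero)) (toℕ (a zero)) (toℕ (b zero))
                          ∣ e ∘ suc ∣ₑ ∣ a ∘ suc ∣ₑ ∣ b ∘ suc ∣ₑ n deg< 2≤deg₀)))
               (zeroʳ _))

evalPoly-orthogonal : {n : ℕ} (c : Coeffs n) (a b : Exp n) →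
                      (∀ e → c e ≢ 0F → ∣ e ∣ₑ + (∣ a ∣ₑ + ∣ b ∣ₑ) < 2 * n) →
                      sum₃ (map (λ x → evalPoly c x *₃ (mono a x *₃ mono b x)) (allFns n)) ≡ 0F
evalPoly-orthogonal {n} c a b deg< = begin
  sum₃ (map (λ x → evalPoly c x *₃ ab x) (allFns n))
    ≡⟨ sum₃-cong (allFns n) (λ x → sum₃-*ʳ (allFns n) (ab x) _) ⟩
  sum₃ (map (λ x → sum₃ (map (λ e → (c e *₃ mono e x) *₃ ab x) (allFns n))) (allFns n))
    ≡⟨ sum₃-comm (allFns n) (allFns n) _ ⟩
  sum₃ (map (λ e → sum₃ (map (λ x → (c e *₃ mono e x) *₃ ab x) (allFns n))) (allFns n))
    ≡⟨ sum₃-cong (allFns n) (λ e → sum₃-cong (allFns n) (λ x → *-assoc (c e) (mono e x) (ab x))) ⟩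
  sum₃ (map (λ e → sum₃ (map (λ x → c e *₃ (mono e x *₃ ab x)) (allFns n))) (allFns n))
    ≡⟨ sum₃-cong (allFns n) (λ e → sum₃-*ˡ (allFns n) (c e) _) ⟨
  sum₃ (map (λ e → c e *₃ tripleMonomialSum n e a b) (allFns n))
    ≡⟨ sum₃-zero (allFns n) _ (λ i → term-vanishes (lookup (allFns n) i)) ⟩
  0F ∎
  where
  open ≡-Reasoning
  ab : Pt n → F3
  ab x = mono a x *₃ mono b x
  term-vanishes : ∀ e → c e *₃ tripleMonomialSum n e a b ≡ 0F
  term-vanishes e with c e ≟F 0F
  ... | yes ce≡0 = cong (_*₃ tripleMonomialSum n e a b) ce≡0
  ... | no ce≢0 = trans (cong (c e *₃_) (tripleMonomialSum-vanishes n e a b (deg< e ce≢0))) (zeroʳ (c e))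

degBound+2d+1 : ∀ n d → degBound n d ℤ.+ (+ 1 ℤ.+ + (2 * d)) ≡ + (2 * n)
degBound+2d+1 n d =
  solve 2 (λ A B → ((A :- B) :- con (+ 1)) :+ (con (+ 1) :+ B) := A) refl (+ (2 * n)) (+ (2 * d))
  where open ℤ-Solver

degBound-total< : ∀ n d e a b → + e ℤ.≤ degBound n d → a ≤ d → b ≤ d → e + (a + b) < 2 * n
degBound-total< n d e a b e≤D a≤d b≤d = ℕ.≤-<-trans e+a+b≤e+2d (ℤP.drop‿+≤+ +[e+2d+1]≤+2n)
  where
  e+a+b≤e+2d : e + (a + b) ≤ e + 2 * d
  e+a+b≤e+2d = ℕ.+-monoʳ-≤ e (ℕ.+-mono-≤ a≤d (ℕ.≤-trans b≤d (ℕ.m≤m+n d 0)))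
  +[e+2d+1]≤+2n : + suc (e + 2 * d) ℤ.≤ + (2 * n)
  +[e+2d+1]≤+2n = begin
    + suc (e + 2 * d)                   ≡⟨ cong +_ (ℕ.+-suc e (2 * d)) ⟨
    + (e + suc (2 * d))                 ≡⟨ ℤP.pos-+ e (suc (2 * d)) ⟩
    + e ℤ.+ (+ 1 ℤ.+ + (2 * d))         ≤⟨ ℤP.+-monoˡ-≤ (+ 1 ℤ.+ + (2 * d)) e≤D ⟩
    degBound n d ℤ.+ (+ 1 ℤ.+ + (2 * d)) ≡⟨ degBound+2d+1 n d ⟩
    + (2 * n)                           ∎
    where open ℤP.≤-Reasoning

disagreements : {n : ℕ} → (Pt n → F3) → (Pt n → F3) → List (Pt n)
disagreements {n} f g = filter (λ x → ¬? (f x ≟F g x)) (allFns n)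

Qβ≡sum-over-disagreements :
  (n d : ℕ) (β : Pt n → F3) (c : Coeffs n) → InPD (degBound n d) c → (i j : Idx n d) →
  Qβ n d β i j ≡ sum₃ (map (λ x → ((β x +₃ (-₃ evalPoly c x)) *₃ eVec d x i) *₃ eVec d x j)
                           (disagreements β (evalPoly c)))
Qβ≡sum-over-disagreements n d β c c∈P (a , a≤d) (b , b≤d) = begin
  sum₃ (map (λ x → β x *₃ ab x) (allFns n))
    ≡⟨ sum₃-cong (allFns n) (λ x → x*z≡[x-y]*z+y*z (β x) (p x) (ab x)) ⟩
  sum₃ (map (λ x → (γ x *₃ ab x) +₃ (p x *₃ ab x)) (allFns n))
    ≡⟨ sum₃-+ (allFns n) _ _ ⟩
  sum₃ (map (λ x → γ x *₃ ab x) (allFns n)) +₃ sum₃ (map (λ x → p x *₃ ab x) (allFns n))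
    ≡⟨ cong (sum₃ (map (λ x → γ x *₃ ab x) (allFns n)) +₃_) (evalPoly-orthogonal c a b deg<) ⟩
  sum₃ (map (λ x → γ x *₃ ab x) (allFns n)) +₃ 0F
    ≡⟨ +-identityʳ _ ⟩
  sum₃ (map (λ x → γ x *₃ ab x) (allFns n))
    ≡⟨ sum₃-filter (λ x → ¬? (β x ≟F p x)) (allFns n) _ agreement-vanishes ⟩
  sum₃ (map (λ x → γ x *₃ ab x) (disagreements β p))
    ≡⟨ sum₃-cong (disagreements β p) (λ x → *-assoc (γ x) (mono a x) (mono b x)) ⟨
  sum₃ (map (λ x → (γ x *₃ mono a x) *₃ mono b x) (disagreements β p)) ∎
  where
  open ≡-Reasoning
  p γ ab : Pt n → F3
  p = evalPoly c
  γ x = β x +₃ (-₃ p x)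
  ab x = mono a x *₃ mono b x
  deg< : ∀ e → c e ≢ 0F → ∣ e ∣ₑ + (∣ a ∣ₑ + ∣ b ∣ₑ) < 2 * n
  deg< e ce≢0 = degBound-total< n d ∣ e ∣ₑ ∣ a ∣ₑ ∣ b ∣ₑ (c∈P e ce≢0) a≤d b≤d
  agreement-vanishes : ∀ x → ¬ (β x ≢ p x) → γ x *₃ ab x ≡ 0F
  agreement-vanishes x β≡p = begin
    (β x +₃ (-₃ p x)) *₃ ab x   ≡⟨ cong (λ y → (y +₃ (-₃ p x)) *₃ ab x) (decidable-stable (β x ≟F p x) β≡p) ⟩
    (p x +₃ (-₃ p x)) *₃ ab x   ≡⟨ cong (_*₃ ab x) (-‿inverseʳ (p x)) ⟩
    0F *₃ ab x                  ≡⟨ zeroˡ (ab x) ⟩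
    0F                          ∎

lemma3p2 : (n d : ℕ) → 1 ≤ n → 1 ≤ d → (β : Pt n → F3) → (δ : ℕ) →
    IsDelta β (degBound n d) δ → RankAtMost (Qβ n d β) δ
lemma3p2 n d _ _ β δ ((c , c∈P , dist≡δ) , _) =
  subst (RankAtMost (Qβ n d β)) dist≡δ
    (RankAtMost-sum-of-outer (Qβ n d β) (disagreements β (evalPoly c))
      (λ x i → (β x +₃ (-₃ evalPoly c x)) *₃ eVec d x i) (λ x j → eVec d x j)
      (Qβ≡sum-over-disagreements n d β c c∈P))
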